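{- For $k\geq 1$ let $G_k=(V_k,E_k)$ be the graph with vertex set $V_k=\{v_0,\ldots,v_{4k}\}$, specified vertex $a=v_0$, and edge set $$E_k=\{(v_0,v_1),(v_0,v_2)\}\cup\bigcup_{i=0}^{k-1}\{(v_{4i+1},v_{4i+2}),(v_{4i+2},v_{4i+3}),(v_{4i+3},v_{4i+4}),(v_{4i+4},v_{4i+1})\}\cup\bigcup_{i=0}^{k-2}\{(v_{4i+4},v_{4i+5}),(v_{4i+3},v_{4i+6})\}.$$ Let $e_i=(v_i,v_{i+1})$, let $T_k^A$ be the spanning tree with edge set $\{e_0,\ldots,e_{4k-1}\}$, and let $T_k^B$ be the spanning tree with edge set $$\{(v_0,v_1),(v_0,v_2)\}\cup\bigcup_{i=0}^{k-1}\{(v_{4i+1},v_{4i+4}),(v_{4i+2},v_{4i+3})\}\cup\bigcup_{i=0}^{k-2}\{(v_{4i+4},v_{4i+5}),(v_{4i+3},v_{4i+6})\}.$$ Let $\ell_k$ be the length of a shortest sequence $T_1,\ldots,T_{\ell_k}$ of spanning trees of $G_k$ with $T_1=T_k^A$, $T_{\ell_k}=T_k^B$, and every pair of consecutive trees adjacent (with respect to $a=v_0$). Then $\ell_k=\Omega(|V_k|^2)$, i.e., there exist constants $c>0$ and $k_0$ such that $\ell_k\geq c|V_k|^2$ for all $k\geq k_0$.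
   Context: Given a graph $G=(V,E)$ with $n$ vertices and a specified vertex $a\in V$, two spanning trees of $G$ are called adjacent (with respect to $a$) if their intersection contains a tree on $n-1$ vertices that includes $a$. Equivalently, viewing trees as rooted at $a$, $T_B$ is adjacent to $T_A$ iff $T_B$ can be obtained from $T_A$ by detaching some leaf $v\neq a$ of $T_A$ from its parent and attaching it (by an edge of $G$) to some vertex. The graph $G_k$ is 2-vertex-connected, and such sequences between any two spanning trees exist. -}

module Defs where

open import Level using (Level) renaming (suc to lsuc)
open import Data.Nat using (ℕ; zero; suc; _+_; _*_; _<_; _≤_)
open import Data.List using (List; []; _∷_; _++_; [_]; length)
open import Data.List.Relation.Unary.Unique.Propositional using (Unique)
open import Data.List.Relation.Unary.Linked using (Linked)
open import Data.Product using (Σ; _×_; _,_)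
open import Data.Sum using (_⊎_)
open import Relation.Nullary using (¬_)
open import Relation.Binary.PropositionalEquality using (_≡_; _≢_)

-- Undirected edge sets on vertices ℕ (vertex v_i is the number i).
-- An edge set is a relation S; the undirected edge {u,v} is present
-- iff S u v or S v u.

EdgeSet : Set₁
EdgeSet = ℕ → ℕ → Set

Adj : EdgeSet → ℕ → ℕ → Set
Adj S u v = S u v ⊎ S v u

_≈E_ : EdgeSet → EdgeSet → Set
S ≈E T = ∀ u v → (Adj S u v → Adj T u v) × (Adj T u v → Adj S u v)

data Path (S : EdgeSet) : ℕ → ℕ → Set where
  here : ∀ {u} → Path S u u
  step : ∀ {u v w} → Adj S u v → Path S v w → Path S u w

Cycle : EdgeSet → Set
Cycle S = Σ ℕ λ x → Σ (List ℕ) λ ys →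
  (2 ≤ length ys) × Unique (x ∷ ys) × Linked (Adj S) (x ∷ ys ++ [ x ])

IsTree : (ℕ → Set) → EdgeSet → Set
IsTree P S =
  (∀ u v → S u v → P u × P v) ×
  (∀ u → ¬ Adj S u u) ×
  (∀ u v → P u → P v → Path S u v) ×
  ¬ Cycle S

nV : ℕ → ℕ
nV k = 4 * k + 1

InV : ℕ → ℕ → Set
InV k v = v < nV k

data GE (k : ℕ) : ℕ → ℕ → Set where
  e01 : GE k 0 1
  e02 : GE k 0 2
  sqA : ∀ i → i < k → GE k (4 * i + 1) (4 * i + 2)
  sqB : ∀ i → i < k → GE k (4 * i + 2) (4 * i + 3)
  sqC : ∀ i → i < k → GE k (4 * i + 3) (4 * i + 4)
  sqD : ∀ i → i < k → GE k (4 * i + 4) (4 * i + 1)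
  brA : ∀ i → suc i < k → GE k (4 * i + 4) (4 * i + 5)
  brB : ∀ i → suc i < k → GE k (4 * i + 3) (4 * i + 6)

data TA (k : ℕ) : ℕ → ℕ → Set where
  e : ∀ i → i < 4 * k → TA k i (suc i)

data TB (k : ℕ) : ℕ → ℕ → Set where
  b01 : TB k 0 1
  b02 : TB k 0 2
  bA  : ∀ i → i < k → TB k (4 * i + 1) (4 * i + 4)
  bB  : ∀ i → i < k → TB k (4 * i + 2) (4 * i + 3)
  bC  : ∀ i → suc i < k → TB k (4 * i + 4) (4 * i + 5)
  bD  : ∀ i → suc i < k → TB k (4 * i + 3) (4 * i + 6)

SpanningTree : ℕ → EdgeSet → Set
SpanningTree k S = (∀ u v → S u v → Adj (GE k) u v) × IsTree (InV k) S

-- adjacency w.r.t. a = v_0: the intersection S ∩ T contains a tree on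
-- n-1 vertices including a, i.e. a tree R ⊆ S ∩ T on V_k ∖ {w}, w ≠ a.
Adjacent : ℕ → EdgeSet → EdgeSet → Set₁
Adjacent k S T = Σ ℕ λ w → InV k w × w ≢ 0 × Σ EdgeSet λ R →
  (∀ u v → R u v → Adj S u v × Adj T u v) ×
  IsTree (λ v → InV k v × v ≢ w) R

data Chain (k : ℕ) : EdgeSet → EdgeSet → ℕ → Set₁ where
  one  : ∀ {S} → SpanningTree k S → Chain k S S 1
  cons : ∀ {S T U L} → SpanningTree k S → Adjacent k S T →
         Chain k T U L → Chain k S U (suc L)

-- Put vertex v of G_k at level ⌈v/2⌉: v₀ is alone on level 0, level j ≥ 1 consists of
-- v_{2j-1} and v_{2j}, and every edge of G_k joins levels at distance at most 1. So G_k is a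
-- ladder, whose rungs are the edges inside a level. Call f a potential for a spanning tree S
-- if every walk in S from v₀ to v uses at least f v rungs. For T_k^A, ⌊v/2⌋ is a potential
-- with sum (2k)² over V_k; T_k^B has no rungs, so its potentials vanish. Let T arise from S by
-- moving the leaf w, and let R ⊆ S ∩ T be the common tree on V ∖ {w}. A simple path of T
-- between vertices other than w lies in R, so a potential for S remains one for T away from w.
-- A walk in T reaches w from a neighbour x after a prefix in R; continue in R to the old
-- neighbour y of w and step to w. The piece from x to y is a simple path between levels at
-- distance at most 2. Its rungs lie on distinct levels, each its lowest level, its highest
-- level, or strictly between the levels of x and y, so it has at most three rungs. Hence
-- lowering the potential at w by 4 gives one for T, and a chain needs at least k² trees.
module Submission where

open import Defs
open import Data.Nat using (ℕ; zero; suc; _+_; _*_; _∸_; _≤_; _<_; z≤n; s≤s; ⌈_/2⌉; ⌊_/2⌋)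
open import Data.Nat.Properties
open import Data.Nat.Tactic.RingSolver using (solve-∀)
open import Algebra.Properties.CommutativeSemigroup +-commutativeSemigroup using (x∙yz≈y∙xz)
open import Data.List using (List; []; _∷_; _++_; [_]; length)
open import Data.List.Properties using (length-++; ++-assoc)
open import Data.List.Relation.Unary.All as All using (All; []; _∷_)
open import Data.List.Relation.Unary.All.Properties using (¬Any⇒All¬; ++⁺; ++⁻ʳ)
open import Data.List.Relation.Unary.Any using (here; there)
open import Data.List.Relation.Unary.AllPairs using ([]; _∷_)
open import Data.List.Relation.Unary.Unique.Propositional using (Unique)
open import Data.List.Relation.Unary.Linked as Linked using (Linked; []; [-]; _∷_)
open import Data.List.Relation.Binary.Subset.Propositional using (_⊆_)
open import Data.List.Membership.Propositional using (_∈_)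
open import Data.List.Membership.Propositional.Properties using (∈-++⁻; ∈-++⁺ʳ)
open import Data.List.Membership.DecPropositional _≟_ using (_∈?_)
open import Data.Product using (Σ; ∃-syntax; _×_; _,_; proj₁; proj₂)
import Data.Product as Product
open import Data.Sum using (_⊎_; inj₁; inj₂; [_,_]′)
import Data.Sum as Sum
open import Data.Empty using (⊥-elim)
open import Function using (id)
open import Relation.Nullary using (¬_; yes; no)
open import Relation.Binary.Definitions using (Symmetric)
open import Relation.Binary.PropositionalEquality hiding ([_])

private variable
  a b c j u v w x y : ℕ
  xs : List ℕ
  P Q R : ℕ → Set
  S S′ : EdgeSet

-- Levels

level : ℕ → ℕ
level v = ⌈ v /2⌉

level≡0 : ∀ x → level x ≡ 0 → x ≡ 0
level≡0 0 _ = refl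

level-pigeonhole : ∀ x y z → level x ≡ level y → level y ≡ level z →
                   x ≡ y ⊎ y ≡ z ⊎ x ≡ z
level-pigeonhole 0 y z p q = inj₁ (sym (level≡0 y (sym p)))
level-pigeonhole x 0 z p q = inj₁ (level≡0 x p)
level-pigeonhole x y 0 p q = inj₂ (inj₁ (level≡0 y q))
level-pigeonhole 1 1 z p q = inj₁ refl
level-pigeonhole 1 y 1 p q = inj₂ (inj₂ refl)
level-pigeonhole x 1 1 p q = inj₂ (inj₁ refl)
level-pigeonhole 1 (suc (suc y)) (suc (suc z)) p q
  with refl ← level≡0 y (suc-injective (sym p))
     | refl ← level≡0 z (suc-injective (sym (trans p q))) = inj₂ (inj₁ refl)
level-pigeonhole (suc (suc x)) 1 (suc (suc z)) p q
  with refl ← level≡0 x (suc-injective p)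
     | refl ← level≡0 z (suc-injective (sym q)) = inj₂ (inj₂ refl)
level-pigeonhole (suc (suc x)) (suc (suc y)) 1 p q
  with refl ← level≡0 x (suc-injective (trans p q))
     | refl ← level≡0 y (suc-injective q) = inj₁ refl
level-pigeonhole (suc (suc x)) (suc (suc y)) (suc (suc z)) p q =
  Sum.map (cong (2 +_)) (Sum.map (cong (2 +_)) (cong (2 +_)))
    (level-pigeonhole x y z (suc-injective p) (suc-injective q))

off-rung : level u ≡ j → level v ≡ j → u ≢ v → x ≢ u → x ≢ v → level x ≢ j
off-rung {u} {j} {v} {x} lu lv u≢v x≢u x≢v lx =
  [ x≢u , [ u≢v , x≢v ]′ ]′ (level-pigeonhole x u v (trans lx (sym lu)) (trans lu (sym lv)))

Within : ℕ → ℕ → ℕ → Set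
Within d u v = level u ≤ d + level v × level v ≤ d + level u

Near : ℕ → ℕ → Set
Near = Within 1

Within-sym : ∀ {d} → Symmetric (Within d)
Within-sym = Product.swap

Within-trans : ∀ {m n} → Within m u v → Within n v w → Within (m + n) u w
Within-trans {u} {v} {w} {m} {n} (uv , vu) (vw , wv) =
  ≤-trans uv (≤-trans (+-monoʳ-≤ m vw) (≤-reflexive (sym (+-assoc m n (level w))))) ,
  ≤-trans wv (≤-trans (+-monoʳ-≤ n vu)
                      (≤-reflexive (trans (x∙yz≈y∙xz n m (level u)) (sym (+-assoc m n (level u))))))

Near-≡ : level u ≡ level v → Near u v
Near-≡ eq = ≤-trans (≤-reflexive eq) (n≤1+n _) , ≤-trans (≤-reflexive (sym eq)) (n≤1+n _)

Near-suc : ∀ {u v} → level v ≡ suc (level u) → Near u v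
Near-suc eq = ≤-trans (n≤1+n _) (≤-trans (≤-reflexive (sym eq)) (n≤1+n _)) , ≤-reflexive eq

-- Walks and their rungs

Adj-rec : (X : ℕ → ℕ → Set) → Symmetric X → (∀ {u v} → S u v → X u v) → Adj S u v → X u v
Adj-rec _ X-sym f (inj₁ s) = f s
Adj-rec _ X-sym f (inj₂ s) = X-sym (f s)

module _ {S : EdgeSet} where

  visits : ∀ {a b} → Path S a b → List ℕ
  visits here               = []
  visits (step {v = v} _ p) = v ∷ visits p

  vertices : ∀ {a b} → Path S a b → List ℕ
  vertices {a} p = a ∷ visits p

  Simple : ∀ {a b} → Path S a b → Set
  Simple p = Unique (vertices p)

  end∈vertices : (p : Path S a b) → b ∈ vertices p
  end∈vertices here       = here refl
  end∈vertices (step _ p) = there (end∈vertices p)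

  visits-end : (p : Path S a b) → visits p ≡ [] ⊎ b ∈ visits p
  visits-end here       = inj₁ refl
  visits-end (step _ p) = inj₂ (end∈vertices p)

  _++ᴾ_ : Path S a b → Path S b c → Path S a c
  here          ++ᴾ q = q
  step edge p ++ᴾ q = step edge (p ++ᴾ q)

  vertices-linked : (p : Path S a b) → Linked (Adj S) (vertices p)
  vertices-linked here          = [-]
  vertices-linked (step edge p) = edge ∷ vertices-linked p

  closed-linked : (p : Path S a b) → Adj S b c → Linked (Adj S) (vertices p ++ [ c ])
  closed-linked here          closing = closing ∷ [-]
  closed-linked (step edge p) closing = edge ∷ closed-linked p closing

  cycle : (p : Path S a b) → Simple p → 2 ≤ length (visits p) → Adj S b a → Cycle S
  cycle {a} p simple long closing = a , visits p , long , simple , closed-linked p closing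

  all-vertices : (∀ {u v} → Adj S u v → Q v) → Q a → (p : Path S a b) → All Q (vertices p)
  all-vertices Q-edge qa here          = qa ∷ []
  all-vertices Q-edge qa (step edge p) = qa ∷ all-vertices Q-edge (Q-edge edge) p

  first-edge : Path S a b → a ≢ b → ∃[ y ] Adj S a y
  first-edge here          a≢b = ⊥-elim (a≢b refl)
  first-edge (step edge _) _   = _ , edge

mapᴾ : (∀ {u v} → Adj S u v → Adj S′ u v) → Path S a b → Path S′ a b
mapᴾ f here          = here
mapᴾ f (step edge p) = step (f edge) (mapᴾ f p)

visits-mapᴾ : (f : ∀ {u v} → Adj S u v → Adj S′ u v) (p : Path S a b) →
              visits (mapᴾ f p) ≡ visits p
visits-mapᴾ f here       = refl
visits-mapᴾ f (step _ p) = cong (_ ∷_) (visits-mapᴾ f p)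

simple-mapᴾ : (f : ∀ {u v} → Adj S u v → Adj S′ u v) (p : Path S a b) →
              Simple p → Simple (mapᴾ f p)
simple-mapᴾ {a = a} f p = subst (λ vs → Unique (a ∷ vs)) (sym (visits-mapᴾ f p))

mapᴾ-within : (Q : ℕ → Set) → (∀ {u v} → Q u → Q v → Adj S u v → Adj S′ u v) →
              (p : Path S a b) → All Q (vertices p) → Path S′ a b
mapᴾ-within Q f here          _                  = here
mapᴾ-within Q f (step edge p) (qu ∷ qs@(qv ∷ _)) = step (f qu qv edge) (mapᴾ-within Q f p qs)

rungAt : ℕ → ℕ → List ℕ
rungAt u v with level u ≟ level v
... | yes _ = [ level u ]
... | no  _ = []

rungAt-≤1 : ∀ u v → length (rungAt u v) ≤ 1
rungAt-≤1 u v with level u ≟ level v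
... | yes _ = ≤-refl
... | no  _ = z≤n

∈-rungAt : j ∈ rungAt u v → level u ≡ j × level v ≡ j
∈-rungAt {j} {u} {v} j∈ with level u ≟ level v | j∈
... | yes lu≡lv | here refl = refl , sym lu≡lv

module _ {S : EdgeSet} where

  rungLevels : Path S a b → List ℕ
  rungLevels here               = []
  rungLevels (step {u} {v} _ p) = rungAt u v ++ rungLevels p

  rungs : Path S a b → ℕ
  rungs p = length (rungLevels p)

  rungs-step : (edge : Adj S u v) (p : Path S v b) →
               rungs (step edge p) ≡ length (rungAt u v) + rungs p
  rungs-step {u} {v} _ p = length-++ (rungAt u v)

  rungs-≤-step : (edge : Adj S u v) (p : Path S v b) → rungs p ≤ rungs (step edge p)
  rungs-≤-step edge p = ≤-trans (m≤n+m (rungs p) _) (≤-reflexive (sym (rungs-step edge p)))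

  rungs-step-≤-suc : (edge : Adj S u v) (p : Path S v b) → rungs (step edge p) ≤ suc (rungs p)
  rungs-step-≤-suc {u} {v} edge p =
    ≤-trans (≤-reflexive (rungs-step edge p)) (+-monoˡ-≤ (rungs p) (rungAt-≤1 u v))

  rungs-step-mono : (edge : Adj S u v) (p : Path S v b) (q : Path S v c) →
                    rungs p ≤ rungs q → rungs (step edge p) ≤ rungs (step edge q)
  rungs-step-mono {u} {v} edge p q p≤q =
    subst₂ _≤_ (sym (rungs-step edge p)) (sym (rungs-step edge q))
           (+-monoʳ-≤ (length (rungAt u v)) p≤q)

  rungLevels-++ : (p : Path S a b) (q : Path S b c) →
                  rungLevels (p ++ᴾ q) ≡ rungLevels p ++ rungLevels q
  rungLevels-++ here               q = refl
  rungLevels-++ (step {u} {v} _ p) q =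
    trans (cong (rungAt u v ++_) (rungLevels-++ p q)) (sym (++-assoc (rungAt u v) _ _))

  rungs-++ : (p : Path S a b) (q : Path S b c) → rungs (p ++ᴾ q) ≡ rungs p + rungs q
  rungs-++ p q = trans (cong length (rungLevels-++ p q)) (length-++ (rungLevels p))

  rungLevels-free : (∀ {u v} → Adj S u v → level u ≢ level v) →
                    (p : Path S a b) → rungLevels p ≡ []
  rungLevels-free free here                = refl
  rungLevels-free free (step {u} {v} uv p) with level u ≟ level v
  ... | yes lu≡lv = ⊥-elim (free uv lu≡lv)
  ... | no  _     = rungLevels-free free p

rungLevels-mapᴾ : (f : ∀ {u v} → Adj S u v → Adj S′ u v) (p : Path S a b) →
                  rungLevels (mapᴾ f p) ≡ rungLevels p
rungLevels-mapᴾ f here               = refl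
rungLevels-mapᴾ f (step {u} {v} _ p) = cong (rungAt u v ++_) (rungLevels-mapᴾ f p)

rungs-mapᴾ : (f : ∀ {u v} → Adj S u v → Adj S′ u v) (p : Path S a b) →
             rungs (mapᴾ f p) ≡ rungs p
rungs-mapᴾ f p = cong length (rungLevels-mapᴾ f p)

rungLevels-mapᴾ-within : (Q : ℕ → Set) (f : ∀ {u v} → Q u → Q v → Adj S u v → Adj S′ u v)
                         (p : Path S a b) (qs : All Q (vertices p)) →
                         rungLevels (mapᴾ-within Q f p qs) ≡ rungLevels p
rungLevels-mapᴾ-within Q f here               _                = refl
rungLevels-mapᴾ-within Q f (step {u} {v} _ p) (_ ∷ qs@(_ ∷ _)) =
  cong (rungAt u v ++_) (rungLevels-mapᴾ-within Q f p qs)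

rungs-mapᴾ-within : (Q : ℕ → Set) (f : ∀ {u v} → Q u → Q v → Adj S u v → Adj S′ u v)
                    (p : Path S a b) (qs : All Q (vertices p)) →
                    rungs (mapᴾ-within Q f p qs) ≡ rungs p
rungs-mapᴾ-within Q f p qs = cong length (rungLevels-mapᴾ-within Q f p qs)

module _ {S : EdgeSet} where

  dropUntil : (p : Path S a b) → Simple p → c ∈ vertices p →
              Σ (Path S c b) λ q → Simple q × rungs q ≤ rungs p
  dropUntil p             simple       (here refl) = p , simple , ≤-refl
  dropUntil (step edge p) (_ ∷ simple) (there c∈)  =
    let q , simple′ , q≤p = dropUntil p simple c∈ in
    q , simple′ , ≤-trans q≤p (rungs-≤-step edge p)

  simplify : (p : Path S a b) → Σ (Path S a b) λ q → Simple q × rungs q ≤ rungs p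
  simplify here = here , [] ∷ [] , ≤-refl
  simplify (step {u} edge p) with simplify p
  ... | q , simple , q≤p with u ∈? vertices q
  ...   | yes u∈ = let q′ , simple′ , q′≤q = dropUntil q simple u∈ in
                   q′ , simple′ , ≤-trans q′≤q (≤-trans q≤p (rungs-≤-step edge p))
  ...   | no  u∉ = step edge q , ¬Any⇒All¬ _ u∉ ∷ simple , rungs-step-mono edge q p q≤p

  first-arrival : (p : Path S a b) → a ≢ b →
                  Σ ℕ λ x → Σ (Path S a x) λ p₀ →
                  Adj S x b × All (_≢ b) (vertices p₀) × rungs p₀ ≤ rungs p
  first-arrival here a≢b = ⊥-elim (a≢b refl)
  first-arrival {a} {b} (step {v = v} edge p) a≢b with v ≟ b
  ... | yes refl = a , here , edge , a≢b ∷ [] , z≤n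
  ... | no  v≢b  =
    let x , p₀ , xb , avoids , p₀≤p = first-arrival p v≢b in
    x , step edge p₀ , xb , a≢b ∷ avoids , rungs-step-mono edge p₀ p p₀≤p

  interior-neighbours : (p : Path S a b) → Simple p → w ∈ vertices p → a ≢ w → b ≢ w →
                        Σ ℕ λ x → Σ ℕ λ y → Adj S x w × Adj S w y × x ≢ y
  interior-neighbours _ _ (here refl) a≢w _ = ⊥-elim (a≢w refl)
  interior-neighbours (step _ here) _ (there (here refl)) _ b≢w = ⊥-elim (b≢w refl)
  interior-neighbours (step xw (step wy _)) ((_ ∷ x≢y ∷ _) ∷ _) (there (here refl)) _ _ =
    _ , _ , xw , wy , x≢y
  interior-neighbours (step _ p@(step _ _)) (_ ∷ simple@(v∉ ∷ _)) (there (there w∈)) _ b≢w =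
    interior-neighbours p simple (there w∈) (All.lookup v∉ w∈) b≢w

-- Simple paths between nearby levels have at most three rungs

Linked-++⁻ : {R : ℕ → ℕ → Set} (xs : List ℕ) {ys : List ℕ} →
             Linked R (xs ++ ys) → Linked R xs × Linked R ys
Linked-++⁻ []           linked       = [] , linked
Linked-++⁻ (_ ∷ [])     linked       = [-] , Linked.tail linked
Linked-++⁻ (_ ∷ y ∷ xs) (r ∷ linked) = Product.map₁ (r ∷_) (Linked-++⁻ (y ∷ xs) linked)

Unique-++⁻ : (xs : List ℕ) {ys : List ℕ} → Unique (xs ++ ys) →
             All (λ x → All (x ≢_) ys) xs × Unique ys
Unique-++⁻ []       unique        = [] , unique
Unique-++⁻ (_ ∷ xs) (x∉ ∷ unique) = Product.map₁ (++⁻ʳ xs x∉ ∷_) (Unique-++⁻ xs unique)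

AtMostOne : (ℕ → Set) → Set
AtMostOne P = ∀ {x y} → P x → P y → x ≡ y

length-≤1 : AtMostOne P → Unique xs → All P xs → length xs ≤ 1
length-≤1 P-one []              []            = z≤n
length-≤1 P-one (_ ∷ [])        (_ ∷ [])      = ≤-refl
length-≤1 P-one ((x≢y ∷ _) ∷ _) (px ∷ py ∷ _) = ⊥-elim (x≢y (P-one px py))

drop-class : AtMostOne P → Unique xs → All (λ x → P x ⊎ Q x) xs →
             ∃[ ys ] Unique ys × All Q ys × ys ⊆ xs × length xs ≤ suc (length ys)
drop-class P-one [] [] = [] , [] , [] , (λ ()) , z≤n
drop-class {xs = x ∷ xs} P-one (x∉ ∷ unique) (inj₁ px ∷ classes) =
  xs , unique ,
  All.tabulate (λ y∈ → [ (λ py → ⊥-elim (All.lookup x∉ y∈ (P-one px py))) , id ]′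
                         (All.lookup classes y∈)) ,
  there , ≤-refl
drop-class {xs = x ∷ xs} P-one (x∉ ∷ unique) (inj₂ qx ∷ classes) =
  let ys , unique′ , qs , ys⊆xs , len = drop-class P-one unique classes in
  x ∷ ys , All.tabulate (λ y∈ → All.lookup x∉ (ys⊆xs y∈)) ∷ unique′ , qx ∷ qs ,
  (λ { (here refl) → here refl ; (there y∈) → there (ys⊆xs y∈) }) , s≤s len

length-≤3 : AtMostOne P → AtMostOne Q → AtMostOne R → Unique xs →
            All (λ x → P x ⊎ Q x ⊎ R x) xs → length xs ≤ 3
length-≤3 P-one Q-one R-one unique classes =
  let ys , unique′ , classes′ , _ , len  = drop-class P-one unique classes
      zs , unique″ , classes″ , _ , len′ = drop-class Q-one unique′ classes′ in
  ≤-trans len (s≤s (≤-trans len′ (s≤s (length-≤1 R-one unique″ classes″))))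

record RungSplit (a b j : ℕ) (zs : List ℕ) : Set where
  constructor rung-split
  field
    pre post   : List ℕ
    from to    : ℕ
    from-level : level from ≡ j
    to-level   : level to ≡ j
    split      : zs ≡ pre ++ from ∷ to ∷ post
    start      : pre ≡ [] ⊎ a ∈ pre
    end        : post ≡ [] ⊎ b ∈ post

module _ {S : EdgeSet} where

  find-rung : (p : Path S a b) → j ∈ rungLevels p → RungSplit a b j (vertices p)
  find-rung (step {u} {v} _ p) j∈ with ∈-++⁻ (rungAt u v) j∈
  ... | inj₁ j∈rung =
    let lu , lv = ∈-rungAt j∈rung in
    rung-split [] (visits p) u v lu lv refl (inj₁ refl) (visits-end p)
  ... | inj₂ j∈rest =
    let rung-split pre post u′ v′ lu lv split _ end = find-rung p j∈rest in
    rung-split (u ∷ pre) post u′ v′ lu lv (cong (u ∷_) split) (inj₂ (here refl)) end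

  rung-level-taken : (p : Path S a b) → Simple p → j ∈ rungLevels p →
                All (x ≢_) (vertices p) → level x ≢ j
  rung-level-taken p simple j∈ x∉ with find-rung p j∈
  ... | rung-split pre post u v lu lv split _ _
    with Unique-++⁻ pre (subst Unique split simple) | ++⁻ʳ pre (subst (All _) split x∉)
  ...  | _ , (u≢v ∷ _) ∷ _ | x≢u ∷ x≢v ∷ _ = off-rung lu lv u≢v x≢u x≢v

  rungLevels-unique : (p : Path S a b) → Simple p → Unique (rungLevels p)
  rungLevels-unique here               _             = []
  rungLevels-unique (step {u} {v} _ p) (u∉ ∷ simple) with level u ≟ level v
  ... | yes _ = All.tabulate (λ j∈ → rung-level-taken p simple j∈ u∉) ∷ rungLevels-unique p simple
  ... | no  _ = rungLevels-unique p simple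

Lowest Highest : List ℕ → ℕ → Set
Lowest  zs j = All (λ z → j ≤ level z) zs × ∃[ z ] z ∈ zs × level z ≡ j
Highest zs j = All (λ z → level z ≤ j) zs × ∃[ z ] z ∈ zs × level z ≡ j

Between : ℕ → ℕ → ℕ → Set
Between m n j = (m < j × j < n) ⊎ (n < j × j < m)

lowest-unique : AtMostOne (Lowest xs)
lowest-unique (i≤ , z , z∈ , lz) (j≤ , z′ , z′∈ , lz′) =
  ≤-antisym (subst (_ ≤_) lz′ (All.lookup i≤ z′∈)) (subst (_ ≤_) lz (All.lookup j≤ z∈))

highest-unique : AtMostOne (Highest xs)
highest-unique (≤i , z , z∈ , lz) (≤j , z′ , z′∈ , lz′) =
  ≤-antisym (subst (_≤ _) lz (All.lookup ≤j z∈)) (subst (_≤ _) lz′ (All.lookup ≤i z′∈))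

squeezed : ∀ {m i n} → m < i → i < n → n ≤ 2 + m → i ≡ suc m
squeezed m<i i<n n≤ = ≤-antisym (≤-pred (≤-trans i<n n≤)) m<i

between-unique : ∀ {m n} → n ≤ 2 + m → m ≤ 2 + n → AtMostOne (Between m n)
between-unique n≤ _ (inj₁ (m<i , i<n)) (inj₁ (m<j , j<n)) =
  trans (squeezed m<i i<n n≤) (sym (squeezed m<j j<n n≤))
between-unique _ m≤ (inj₂ (n<i , i<m)) (inj₂ (n<j , j<m)) =
  trans (squeezed n<i i<m m≤) (sym (squeezed n<j j<m m≤))
between-unique _ _ (inj₁ (m<i , i<n)) (inj₂ (n<j , j<m)) =
  ⊥-elim (<-asym (<-trans m<i i<n) (<-trans n<j j<m))
between-unique _ _ (inj₂ (n<i , i<m)) (inj₁ (m<j , j<n)) =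
  ⊥-elim (<-asym (<-trans n<i i<m) (<-trans m<j j<n))

OneSided : ℕ → List ℕ → Set
OneSided j zs = All (λ z → level z < j) zs ⊎ All (λ z → j < level z) zs

one-sided : Linked Near xs → All (λ z → level z ≢ j) xs → OneSided j xs
one-sided []  [] = inj₁ []
one-sided {xs = x ∷ []} {j} [-] (x≢j ∷ []) =
  Sum.map (λ x≤j → ≤∧≢⇒< x≤j x≢j ∷ []) (_∷ []) (≤-<-connex (level x) j)
one-sided (xy ∷ linked) (x≢j ∷ avoids) with one-sided linked avoids
... | inj₁ below@(y<j ∷ _) = inj₁ (≤∧≢⇒< (≤-trans (proj₁ xy) y<j) x≢j ∷ below)
... | inj₂ above@(j<y ∷ _) = inj₂ (≤∧≢⇒< (≤-pred (≤-trans j<y (proj₂ xy))) (≢-sym x≢j) ∷ above)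

below-part : OneSided j xs → xs ≡ [] ⊎ x ∈ xs → level x ≤ j → All (λ z → level z ≤ j) xs
below-part (inj₁ below) _           _   = All.map <⇒≤ below
below-part (inj₂ _)     (inj₁ refl) _   = []
below-part (inj₂ above) (inj₂ x∈)   x≤j = ⊥-elim (<⇒≱ (All.lookup above x∈) x≤j)

above-part : OneSided j xs → xs ≡ [] ⊎ x ∈ xs → j ≤ level x → All (λ z → j ≤ level z) xs
above-part (inj₂ above) _           _   = All.map <⇒≤ above
above-part (inj₁ _)     (inj₁ refl) _   = []
above-part (inj₁ below) (inj₂ x∈)   j≤x = ⊥-elim (<⇒≱ (All.lookup below x∈) j≤x)

rung-sides : ∀ pre {post} → Linked Near (pre ++ u ∷ v ∷ post) → Unique (pre ++ u ∷ v ∷ post) →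
             level u ≡ j → level v ≡ j → OneSided j pre × OneSided j post
rung-sides pre linked unique lu lv with Unique-++⁻ pre unique | Linked-++⁻ pre linked
... | pre-distinct , (u≢v ∷ u∉post) ∷ v∉post ∷ _ | pre-linked , rest-linked =
  one-sided pre-linked (All.map (λ { (z≢u ∷ z≢v ∷ _) → off-rung lu lv u≢v z≢u z≢v }) pre-distinct) ,
  one-sided (Linked.tail (Linked.tail rest-linked))
            (All.zipWith (λ (u≢z , v≢z) → off-rung lu lv u≢v (≢-sym u≢z) (≢-sym v≢z))
                         (u∉post , v∉post))

classify-rung : ∀ {zs} → Linked Near zs → Unique zs → RungSplit a b j zs →
                Lowest zs j ⊎ Highest zs j ⊎ Between (level a) (level b) j
classify-rung {a} {b} {j} linked unique (rung-split pre post u v lu lv refl start end) =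
  by-endpoints (≤-<-connex (level a) j) (≤-<-connex (level b) j)
  where
  zs : List ℕ
  zs = pre ++ u ∷ v ∷ post

  sides : OneSided j pre × OneSided j post
  sides = rung-sides pre linked unique lu lv

  lowest : j ≤ level a → j ≤ level b → Lowest zs j
  lowest j≤a j≤b =
    ++⁺ (above-part (proj₁ sides) start j≤a)
        (≤-reflexive (sym lu) ∷ ≤-reflexive (sym lv) ∷ above-part (proj₂ sides) end j≤b) ,
    u , ∈-++⁺ʳ pre (here refl) , lu

  highest : level a ≤ j → level b ≤ j → Highest zs j
  highest a≤j b≤j =
    ++⁺ (below-part (proj₁ sides) start a≤j)
        (≤-reflexive lu ∷ ≤-reflexive lv ∷ below-part (proj₂ sides) end b≤j) ,
    u , ∈-++⁺ʳ pre (here refl) , lu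

  by-endpoints : level a ≤ j ⊎ j < level a → level b ≤ j ⊎ j < level b →
                 Lowest zs j ⊎ Highest zs j ⊎ Between (level a) (level b) j
  by-endpoints (inj₁ a≤j) (inj₁ b≤j) = inj₂ (inj₁ (highest a≤j b≤j))
  by-endpoints (inj₂ j<a) (inj₂ j<b) = inj₁ (lowest (<⇒≤ j<a) (<⇒≤ j<b))
  by-endpoints (inj₁ a≤j) (inj₂ j<b) with m≤n⇒m<n∨m≡n a≤j
  ... | inj₁ a<j = inj₂ (inj₂ (inj₁ (a<j , j<b)))
  ... | inj₂ a≡j = inj₁ (lowest (≤-reflexive (sym a≡j)) (<⇒≤ j<b))
  by-endpoints (inj₂ j<a) (inj₁ b≤j) with m≤n⇒m<n∨m≡n b≤j
  ... | inj₁ b<j = inj₂ (inj₂ (inj₂ (b<j , j<a)))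
  ... | inj₂ b≡j = inj₁ (lowest (<⇒≤ j<a) (≤-reflexive (sym b≡j)))

ladder : (∀ {u v} → Adj S u v → Near u v) → (p : Path S a b) → Simple p → Within 2 a b →
         rungs p ≤ 3
ladder near p simple (a≤ , b≤) =
  length-≤3 lowest-unique highest-unique (between-unique b≤ a≤) (rungLevels-unique p simple)
    (All.tabulate λ j∈ →
      classify-rung (Linked.map near (vertices-linked p)) simple (find-rung p j∈))

-- Moving a leaf

module Tree {P : ℕ → Set} {S : EdgeSet} (tree : IsTree P S) where

  endpoints : Adj S u v → P u × P v
  endpoints = Adj-rec (λ u v → P u × P v) Product.swap (λ {u} {v} s → proj₁ tree u v s)

  loopless : ¬ Adj S u u
  loopless = proj₁ (proj₂ tree) _

  connect : P u → P v → Path S u v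
  connect = proj₁ (proj₂ (proj₂ tree)) _ _

  neighbour : Adj S u v → P v × v ≢ u
  neighbour {u} uv = proj₂ (endpoints uv) , λ v≡u → loopless (subst (Adj S u) v≡u uv)

  acyclic : ¬ Cycle S
  acyclic = proj₂ (proj₂ (proj₂ tree))

NeedsRungs : EdgeSet → ℕ → ℕ → Set
NeedsRungs S v r = (p : Path S 0 v) → r ≤ rungs p

module Exchange {V : ℕ → Set} {S T R : EdgeSet} {w : ℕ}
  (S-tree : IsTree V S) (T-tree : IsTree V T)
  (S-near : ∀ {u v} → Adj S u v → Near u v) (T-near : ∀ {u v} → Adj T u v → Near u v)
  (0∈V : V 0) (w∈V : V w) (w≢0 : w ≢ 0)
  (R⊆S∩T : ∀ u v → R u v → Adj S u v × Adj T u v)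
  (R-tree : IsTree (λ v → V v × v ≢ w) R) where

  private
    module TreeS = Tree S-tree
    module TreeT = Tree T-tree
    module TreeR = Tree R-tree

  Rest : ℕ → Set
  Rest v = V v × v ≢ w

  R⇒S : Adj R u v → Adj S u v
  R⇒S = Adj-rec (Adj S) Sum.swap (λ {u} {v} r → proj₁ (R⊆S∩T u v r))

  R⇒T : Adj R u v → Adj T u v
  R⇒T = Adj-rec (Adj T) Sum.swap (λ {u} {v} r → proj₂ (R⊆S∩T u v r))

  -- R joins any two neighbours of w while avoiding w, so they would close a cycle of T.
  T-leaf : Adj T w x → Adj T w y → x ≡ y
  T-leaf {x} {y} wx wy with x ≟ y
  ... | yes x≡y = x≡y
  ... | no  x≢y with simplify (TreeR.connect (TreeT.neighbour wx) (TreeT.neighbour wy))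
  ...   | here , _ = ⊥-elim (x≢y refl)
  ...   | r@(step _ _) , simple , _ =
    ⊥-elim (TreeT.acyclic (cycle (step wx (mapᴾ R⇒T r)) (w∉ ∷ simple-mapᴾ R⇒T r simple)
                                 (s≤s (s≤s z≤n)) (Sum.swap wy)))
    where
    w∉ : All (w ≢_) (vertices (mapᴾ R⇒T r))
    w∉ = subst (All (w ≢_)) (cong (x ∷_) (sym (visits-mapᴾ R⇒T r)))
               (All.map (λ z-rest → ≢-sym (proj₂ z-rest))
                        (all-vertices (λ edge → proj₂ (TreeR.endpoints edge)) (TreeT.neighbour wx) r))

  T-edge-in-S : u ≢ w → v ≢ w → Adj T u v → Adj S u v
  T-edge-in-S {u} {v} u≢w v≢w uv
    with simplify (TreeR.connect (proj₁ (TreeT.endpoints uv) , u≢w) (proj₂ (TreeT.endpoints uv) , v≢w))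
  ... | here , _ = ⊥-elim (TreeT.loopless uv)
  ... | step ru here , _ = R⇒S ru
  ... | r@(step _ (step _ _)) , simple , _ =
    ⊥-elim (TreeT.acyclic (cycle (mapᴾ R⇒T r) (simple-mapᴾ R⇒T r simple) (s≤s (s≤s z≤n))
                                 (Sum.swap uv)))

  T⇒S : (p : Path T a b) → All (_≢ w) (vertices p) → Path S a b
  T⇒S = mapᴾ-within (_≢ w) T-edge-in-S

  rungs-T⇒S : (p : Path T a b) (avoids : All (_≢ w) (vertices p)) → rungs (T⇒S p avoids) ≡ rungs p
  rungs-T⇒S = rungs-mapᴾ-within (_≢ w) T-edge-in-S

  simple-avoids-leaf : (p : Path T a b) → Simple p → a ≢ w → b ≢ w → All (_≢ w) (vertices p)
  simple-avoids-leaf p simple a≢w b≢w = All.tabulate λ z∈ z≡w →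
    let x , y , xw , wy , x≢y =
          interior-neighbours p simple (subst (_∈ vertices p) z≡w z∈) a≢w b≢w in
    x≢y (T-leaf (Sum.swap xw) wy)

  needs-kept : v ≢ w → NeedsRungs S v j → NeedsRungs T v j
  needs-kept v≢w needs p =
    let q , simple , q≤p = simplify p
        avoids = simple-avoids-leaf q simple (≢-sym w≢0) v≢w in
    ≤-trans (needs (T⇒S q avoids)) (≤-trans (≤-reflexive (rungs-T⇒S q avoids)) q≤p)

  bridge : Rest x → Rest y → Within 2 x y → Σ (Path S x y) λ q → rungs q ≤ 3
  bridge x∈ y∈ close =
    let r , simple , _ = simplify (TreeR.connect x∈ y∈) in
    mapᴾ R⇒S r ,
    ≤-trans (≤-reflexive (rungs-mapᴾ R⇒S r)) (ladder (λ edge → S-near (R⇒S edge)) r simple close)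

  -- Reach the new neighbour x of w as in T, cross inside R to the old neighbour y, step to w.
  needs-moved : NeedsRungs S w j → NeedsRungs T w (j ∸ 4)
  needs-moved {j} needs p
    with first-arrival p (≢-sym w≢0) | first-edge (TreeS.connect w∈V 0∈V) w≢0
  ... | x , p₀ , xw , avoids , p₀≤p | y , wy
    with bridge (TreeT.neighbour (Sum.swap xw)) (TreeS.neighbour wy)
                (Within-trans (T-near xw) (S-near wy))
  ... | q , q≤3 = m≤n+o⇒m∸n≤o j 4 (begin
    j                                     ≤⟨ needs (T⇒S p₀ avoids ++ᴾ detour) ⟩
    rungs (T⇒S p₀ avoids ++ᴾ detour)      ≡⟨ rungs-++ (T⇒S p₀ avoids) detour ⟩
    rungs (T⇒S p₀ avoids) + rungs detour  ≤⟨ +-mono-≤ p₀-rungs detour-rungs ⟩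
    rungs p + 4                           ≡⟨ +-comm (rungs p) 4 ⟩
    4 + rungs p                           ∎)
    where
    open ≤-Reasoning
    detour : Path S x w
    detour = q ++ᴾ step (Sum.swap wy) here
    p₀-rungs : rungs (T⇒S p₀ avoids) ≤ rungs p
    p₀-rungs = ≤-trans (≤-reflexive (rungs-T⇒S p₀ avoids)) p₀≤p
    detour-rungs : rungs detour ≤ 4
    detour-rungs = ≤-trans (≤-reflexive (rungs-++ q _))
                           (+-mono-≤ q≤3 (rungs-step-≤-suc {S = S} (Sum.swap wy) here))

-- The graph G_k and the trees T_k^A, T_k^B

level-4*+ : ∀ i c → level (4 * i + c) ≡ 2 * i + level c
level-4*+ zero    c = refl
level-4*+ (suc i) c = begin
  level (4 * suc i + c)  ≡⟨ cong level (unfold₄ i c) ⟩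
  2 + level (4 * i + c)  ≡⟨ cong (2 +_) (level-4*+ i c) ⟩
  2 + (2 * i + level c)  ≡⟨ fold₂ i (level c) ⟩
  2 * suc i + level c    ∎
  where
  open ≡-Reasoning
  unfold₄ : ∀ i c → 4 * suc i + c ≡ 4 + (4 * i + c)
  unfold₄ = solve-∀
  fold₂ : ∀ i x → 2 + (2 * i + x) ≡ 2 * suc i + x
  fold₂ = solve-∀

level-shift : ∀ i c d n → level d ≡ n + level c → level (4 * i + d) ≡ n + level (4 * i + c)
level-shift i c d n eq = begin
  level (4 * i + d)      ≡⟨ level-4*+ i d ⟩
  2 * i + level d        ≡⟨ cong (2 * i +_) eq ⟩
  2 * i + (n + level c)  ≡⟨ x∙yz≈y∙xz (2 * i) n (level c) ⟩
  n + (2 * i + level c)  ≡⟨ cong (n +_) (sym (level-4*+ i c)) ⟩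
  n + level (4 * i + c)  ∎
  where open ≡-Reasoning

GE-near : ∀ {k} → GE k u v → Near u v
GE-near e01       = Near-suc {0} {1} refl
GE-near e02       = Near-suc {0} {2} refl
GE-near (sqA i _) = Near-≡ (level-shift i 2 1 0 refl)
GE-near (sqB i _) = Near-suc (level-shift i 2 3 1 refl)
GE-near (sqC i _) = Near-≡ (level-shift i 4 3 0 refl)
GE-near (sqD i _) = Within-sym (Near-suc (level-shift i 1 4 1 refl))
GE-near (brA i _) = Near-suc (level-shift i 4 5 1 refl)
GE-near (brB i _) = Near-suc (level-shift i 3 6 1 refl)

G-near : ∀ {k} → SpanningTree k S → Adj S u v → Near u v
G-near {k = k} (S⊆G , _) uv =
  Adj-rec Near Within-sym GE-near (Adj-rec (Adj (GE k)) Sum.swap (λ {u} {v} s → S⊆G u v s) uv)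

v₀∈V : ∀ k → InV k 0
v₀∈V k = m≤n+m 1 (4 * k)

TB-level : ∀ {k} → TB k u v → level v ≡ suc (level u)
TB-level b01      = refl
TB-level b02      = refl
TB-level (bA i _) = level-shift i 1 4 1 refl
TB-level (bB i _) = level-shift i 2 3 1 refl
TB-level (bC i _) = level-shift i 4 5 1 refl
TB-level (bD i _) = level-shift i 3 6 1 refl

TB-rung-free : ∀ {k U} → U ≈E TB k → Adj U u v → level u ≢ level v
TB-rung-free U≈TB uv =
  Adj-rec (λ u v → level u ≢ level v) ≢-sym
          (λ tb lu≡lv → 1+n≢n (trans (sym (TB-level tb)) (sym lu≡lv)))
          (proj₁ (U≈TB _ _) uv)

⌈n/2⌉≤1+⌊n/2⌋ : ∀ n → ⌈ n /2⌉ ≤ suc ⌊ n /2⌋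
⌈n/2⌉≤1+⌊n/2⌋ 0             = z≤n
⌈n/2⌉≤1+⌊n/2⌋ 1             = ≤-refl
⌈n/2⌉≤1+⌊n/2⌋ (suc (suc n)) = s≤s (⌈n/2⌉≤1+⌊n/2⌋ n)

-- ⌊ suc u /2⌋ is level u, and level (suc u) is suc ⌊ u /2⌋.
⌊/2⌋-step : v ≡ suc u ⊎ u ≡ suc v → ⌊ v /2⌋ ≤ ⌊ u /2⌋ + length (rungAt u v)
⌊/2⌋-step {u = u} (inj₁ refl) with level u ≟ level (suc u)
... | yes _     = ≤-trans (⌈n/2⌉≤1+⌊n/2⌋ u) (≤-reflexive (+-comm 1 ⌊ u /2⌋))
... | no  lu≢lv = ≤-trans (≤-pred (≤∧≢⇒< (⌈n/2⌉≤1+⌊n/2⌋ u) lu≢lv)) (m≤m+n ⌊ u /2⌋ 0)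
⌊/2⌋-step {v = v} (inj₂ refl) = ≤-trans (⌊n/2⌋-mono (n≤1+n v)) (m≤m+n _ _)

TA-consecutive : ∀ {k} → S ≈E TA k → Adj S u v → v ≡ suc u ⊎ u ≡ suc v
TA-consecutive S≈TA uv with proj₁ (S≈TA _ _) uv
... | inj₁ (e _ _) = inj₁ refl
... | inj₂ (e _ _) = inj₂ refl

TA-rungs : ∀ {k} → S ≈E TA k → (p : Path S a b) → ⌊ b /2⌋ ≤ ⌊ a /2⌋ + rungs p
TA-rungs S≈TA here = m≤m+n _ 0
TA-rungs {a = a} {b} S≈TA (step {v = v} uv p) = begin
  ⌊ b /2⌋                                    ≤⟨ TA-rungs S≈TA p ⟩
  ⌊ v /2⌋ + rungs p                          ≤⟨ +-monoˡ-≤ (rungs p) (⌊/2⌋-step (TA-consecutive S≈TA uv)) ⟩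
  ⌊ a /2⌋ + length (rungAt a v) + rungs p    ≡⟨ +-assoc ⌊ a /2⌋ _ (rungs p) ⟩
  ⌊ a /2⌋ + (length (rungAt a v) + rungs p)  ≡⟨ cong (⌊ a /2⌋ +_) (sym (rungs-step uv p)) ⟩
  ⌊ a /2⌋ + rungs (step uv p)                ∎
  where open ≤-Reasoning

-- Summing the potential

∑< : ℕ → (ℕ → ℕ) → ℕ
∑< zero    f = 0
∑< (suc n) f = ∑< n f + f n

∑<-zero : ∀ n {f} → (∀ v → v < n → f v ≤ 0) → ∑< n f ≤ 0
∑<-zero zero    _   = z≤n
∑<-zero (suc n) f≤0 = +-mono-≤ (∑<-zero n λ v v<n → f≤0 v (m<n⇒m<1+n v<n)) (f≤0 n ≤-refl)

∑<-mono : ∀ n {f g} → (∀ v → v < n → f v ≤ g v) → ∑< n f ≤ ∑< n g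
∑<-mono zero    _   = z≤n
∑<-mono (suc n) f≤g = +-mono-≤ (∑<-mono n λ v v<n → f≤g v (m<n⇒m<1+n v<n)) (f≤g n ≤-refl)

∑<-mono-except : ∀ n {f g w c} → (∀ v → v ≢ w → f v ≤ g v) → f w ≤ c + g w →
                 ∑< n f ≤ c + ∑< n g
∑<-mono-except zero _ _ = z≤n
∑<-mono-except (suc n) {f} {g} {w} {c} f≤g fw≤ with n ≟ w
... | yes refl = begin
  ∑< n f + f n        ≤⟨ +-mono-≤ (∑<-mono n λ v v<n → f≤g v (<⇒≢ v<n)) fw≤ ⟩
  ∑< n g + (c + g n)  ≡⟨ x∙yz≈y∙xz (∑< n g) c (g n) ⟩
  c + (∑< n g + g n)  ∎
  where open ≤-Reasoning
... | no n≢w = begin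
  ∑< n f + f n        ≤⟨ +-mono-≤ (∑<-mono-except n f≤g fw≤) (f≤g n n≢w) ⟩
  c + ∑< n g + g n    ≡⟨ +-assoc c (∑< n g) (g n) ⟩
  c + (∑< n g + g n)  ∎
  where open ≤-Reasoning

⌊n+n/2⌋≡n : ∀ n → ⌊ n + n /2⌋ ≡ n
⌊n+n/2⌋≡n zero    = refl
⌊n+n/2⌋≡n (suc n) = trans (cong (λ m → ⌊ suc m /2⌋) (+-suc n n)) (cong suc (⌊n+n/2⌋≡n n))

⌊1+n+n/2⌋≡n : ∀ n → ⌊ suc (n + n) /2⌋ ≡ n
⌊1+n+n/2⌋≡n zero    = refl
⌊1+n+n/2⌋≡n (suc n) = cong suc (trans (cong ⌊_/2⌋ (+-suc n n)) (⌊1+n+n/2⌋≡n n))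

∑<-⌊/2⌋ : ∀ m → ∑< (suc (m + m)) ⌊_/2⌋ ≡ m * m
∑<-⌊/2⌋ zero    = refl
∑<-⌊/2⌋ (suc m) = begin
  ∑< (suc (suc m + suc m)) ⌊_/2⌋
    ≡⟨ cong (λ n → ∑< (suc (suc n)) ⌊_/2⌋) (+-suc m m) ⟩
  ∑< (suc (m + m)) ⌊_/2⌋ + ⌊ suc (m + m) /2⌋ + suc ⌊ m + m /2⌋
    ≡⟨ cong₂ _+_ (cong₂ _+_ (∑<-⌊/2⌋ m) (⌊1+n+n/2⌋≡n m)) (cong suc (⌊n+n/2⌋≡n m)) ⟩
  m * m + m + suc m
    ≡⟨ square-suc m ⟩
  suc m * suc m
    ∎
  where
  open ≡-Reasoning
  square-suc : ∀ m → m * m + m + suc m ≡ suc m * suc m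
  square-suc = solve-∀

chain-head : ∀ {k S U L} → Chain k S U L → SpanningTree k S
chain-head (one tree)      = tree
chain-head (cons tree _ _) = tree

potential-bound : ∀ {k S U L} → Chain k S U L → U ≈E TB k → (f : ℕ → ℕ) →
                  (∀ v → InV k v → NeedsRungs S v (f v)) → ∑< (nV k) f ≤ 4 * L
potential-bound {k} {U} (one (_ , U-tree)) U≈TB f needs =
  ≤-trans (∑<-zero (nV k) λ v v∈V →
             subst (f v ≤_) (cong length (rungLevels-free (TB-rung-free U≈TB) (connect v∈V)))
                   (needs v v∈V (connect v∈V)))
          z≤n
  where
  connect : ∀ {v} → InV k v → Path U 0 v
  connect = Tree.connect U-tree (v₀∈V k)
potential-bound {k} {L = suc L}
                (cons {T = T} S-tree (w , w∈V , w≢0 , R , R⊆S∩T , R-tree) chain) U≈TB f needs =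
  begin
    ∑< (nV k) f       ≤⟨ ∑<-mono-except (nV k) f≤f′ f≤4+f′ ⟩
    4 + ∑< (nV k) f′  ≤⟨ +-monoʳ-≤ 4 (potential-bound chain U≈TB f′ needs′) ⟩
    4 + 4 * L         ≡⟨ sym (*-suc 4 L) ⟩
    4 * suc L         ∎
  where
  open ≤-Reasoning
  T-tree : SpanningTree k T
  T-tree = chain-head chain
  open Exchange (proj₂ S-tree) (proj₂ T-tree) (G-near S-tree) (G-near T-tree)
                (v₀∈V k) w∈V w≢0 R⊆S∩T R-tree
  f′ : ℕ → ℕ
  f′ v with v ≟ w
  ... | yes _ = f v ∸ 4
  ... | no  _ = f v
  needs′ : ∀ v → InV k v → NeedsRungs T v (f′ v)
  needs′ v v∈V with v ≟ w
  ... | yes refl = needs-moved (needs w w∈V)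
  ... | no  v≢w  = needs-kept v≢w (needs v v∈V)
  f≤f′ : ∀ v → v ≢ w → f v ≤ f′ v
  f≤f′ v v≢w with v ≟ w
  ... | yes v≡w = ⊥-elim (v≢w v≡w)
  ... | no  _   = ≤-refl
  f≤4+f′ : f w ≤ 4 + f′ w
  f≤4+f′ with w ≟ w
  ... | yes _   = m≤n+m∸n (f w) 4
  ... | no  w≢w = ⊥-elim (w≢w refl)

nV≡1+2k+2k : ∀ k → nV k ≡ suc (2 * k + 2 * k)
nV≡1+2k+2k = regroup
  where
  regroup : ∀ k → 4 * k + 1 ≡ suc (2 * k + 2 * k)
  regroup = solve-∀

nV≤3*2k : ∀ k → 1 ≤ k → nV k ≤ 3 * (2 * k)
nV≤3*2k (suc k) _ = ≤-trans (m≤m+n (nV (suc k)) (suc (2 * k))) (≤-reflexive (slack k))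
  where
  slack : ∀ k → 4 * suc k + 1 + suc (2 * k) ≡ 3 * (2 * suc k)
  slack = solve-∀

chain-length : ∀ {k S U L} → Chain k S U L → S ≈E TA k → U ≈E TB k → 2 * k * (2 * k) ≤ 4 * L
chain-length {k} {L = L} chain S≈TA U≈TB = begin
  2 * k * (2 * k)                 ≡⟨ sym (∑<-⌊/2⌋ (2 * k)) ⟩
  ∑< (suc (2 * k + 2 * k)) ⌊_/2⌋  ≡⟨ cong (λ n → ∑< n ⌊_/2⌋) (sym (nV≡1+2k+2k k)) ⟩
  ∑< (nV k) ⌊_/2⌋                 ≤⟨ potential-bound chain U≈TB ⌊_/2⌋ (λ _ _ → TA-rungs S≈TA) ⟩
  4 * L                           ∎
  where open ≤-Reasoning

chain-length-quadratic : ∀ {k S U L} → 1 ≤ k → Chain k S U L → S ≈E TA k → U ≈E TB k →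
                         nV k * nV k ≤ 36 * L
chain-length-quadratic {k} {L = L} 1≤k chain S≈TA U≈TB = begin
  nV k * nV k                  ≤⟨ *-mono-≤ (nV≤3*2k k 1≤k) (nV≤3*2k k 1≤k) ⟩
  3 * (2 * k) * (3 * (2 * k))  ≡⟨ nine (2 * k) ⟩
  9 * (2 * k * (2 * k))        ≤⟨ *-monoʳ-≤ 9 (chain-length chain S≈TA U≈TB) ⟩
  9 * (4 * L)                  ≡⟨ sym (*-assoc 9 4 L) ⟩
  36 * L                       ∎
  where
  open ≤-Reasoning
  nine : ∀ m → 3 * m * (3 * m) ≡ 9 * (m * m)
  nine = solve-∀

theorem2 : Σ ℕ λ p → Σ ℕ λ q → Σ ℕ λ k₀ → 0 < p × 0 < q ×
    (∀ k → 1 ≤ k → k₀ ≤ k → ∀ S U L → S ≈E TA k → U ≈E TB k →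
      Chain k S U L → p * (nV k * nV k) ≤ q * L)
theorem2 = 1 , 36 , 1 , s≤s z≤n , s≤s z≤n , λ k 1≤k _ S U L S≈TA U≈TB chain →
  ≤-trans (≤-reflexive (*-identityˡ (nV k * nV k))) (chain-length-quadratic 1≤k chain S≈TA U≈TB)
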